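{- $\mathrm{SO}\text{ - }\mathrm{EKROM}$ is closed under substructures: if $\Phi$ is an $\mathrm{SO}\text{ - }\mathrm{EKROM}(\tau)$ sentence, $\mathcal{A}$ is a finite $\tau$-structure with $\mathcal{A}\models\Phi$, and $\mathcal{B}$ is a substructure of $\mathcal{A}$, then $\mathcal{B}\models\Phi$.
   Context: Vocabularies $\tau$ consist of constant and relation symbols and always contain equality. $\mathrm{SO}\text{ - }\mathrm{EKROM}(\tau)$ is the set of sentences of the form $\forall X_1\exists Y_1\cdots\forall X_k\exists Y_k\forall\bar{x}(C_1\wedge\cdots\wedge C_n)$, where each $C_i$ is a disjunction $\alpha_1\vee\cdots\vee\alpha_l\vee H_1\vee H_2$ in which each $\alpha_s$ is $Q\bar{y}$ or $\neg Q\bar{y}$ with $Q\in\tau\cup\{X_1,\dots,X_k\}$, and each $H_t$ is $Y_i\bar{z}$ or $\neg Y_i\bar{z}$ for some $1\le i\le k$. -}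

module Defs where

open import Data.Nat using (ℕ; _≤_)
open import Data.Fin using (Fin; _≟_)
open import Data.Bool using (Bool; true; false; not)
open import Data.Vec using (Vec) renaming (map to vmap)
open import Data.List using (List; []; _∷_; length; lookup)
open import Data.List.Relation.Unary.All using (All)
open import Data.List.Relation.Unary.Any using (Any)
open import Data.Product using (_×_; _,_; proj₁; proj₂; Σ)
open import Data.Sum using (_⊎_)
open import Data.Unit using (⊤; tt)
open import Relation.Nullary.Decidable using (⌊_⌋)
open import Relation.Binary.PropositionalEquality using (_≡_)
open import Function.Definitions using (Injective)

record Vocab : Set where
  field
    nConst : ℕ
    nRel   : ℕ
    arity  : Fin nRel → ℕ
open Vocab public

Rel : ℕ → ℕ → Set
Rel n a = Vec (Fin n) a → Bool

record Structure (τ : Vocab) (n : ℕ) : Set where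
  field
    const : Fin (nConst τ) → Fin n
    rel   : (r : Fin (nRel τ)) → Rel n (arity τ r)
open Structure public

-- B is a substructure of A: B is (identified via an injective map with)
-- a subset of A's universe, containing the constants, with the relations
-- of A restricted to it.
record Substructure {τ : Vocab} {m n : ℕ}
                    (B : Structure τ m) (A : Structure τ n) : Set where
  field
    emb     : Fin m → Fin n
    emb-inj : Injective _≡_ _≡_ emb
    emb-const : ∀ c → emb (const B c) ≡ const A c
    emb-rel   : ∀ r (v : Vec (Fin m) (arity τ r)) →
                rel B r v ≡ rel A r (vmap emb v)

-- Syntax of SO-EKROM(τ).
-- A quantifier prefix ∀X₁∃Y₁⋯∀Xₖ∃Yₖ is a list of pairs (arity Xᵢ , arity Yᵢ).

Prefix : Set
Prefix = List (ℕ × ℕ)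

xAr : (ps : Prefix) → Fin (length ps) → ℕ
xAr ps i = proj₁ (lookup ps i)

yAr : (ps : Prefix) → Fin (length ps) → ℕ
yAr ps i = proj₂ (lookup ps i)

data Term (τ : Vocab) (nv : ℕ) : Set where
  var : Fin nv → Term τ nv
  con : Fin (nConst τ) → Term τ nv

data Atom (τ : Vocab) (ps : Prefix) (nv : ℕ) : Set where
  eqA  : Term τ nv → Term τ nv → Atom τ ps nv
  relA : (r : Fin (nRel τ)) → Vec (Term τ nv) (arity τ r) → Atom τ ps nv
  xA   : (i : Fin (length ps)) → Vec (Term τ nv) (xAr ps i) → Atom τ ps nv

data YAtom (τ : Vocab) (ps : Prefix) (nv : ℕ) : Set where
  yA : (i : Fin (length ps)) → Vec (Term τ nv) (yAr ps i) → YAtom τ ps nv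

-- literals: (true , a) is a, (false , a) is ¬ a
Lit : Set → Set
Lit A = Bool × A

record Clause (τ : Vocab) (ps : Prefix) (nv : ℕ) : Set where
  field
    αs    : List (Lit (Atom τ ps nv))
    hs    : List (Lit (YAtom τ ps nv))
    hs≤2  : length hs ≤ 2
open Clause public

record EKROM (τ : Vocab) : Set where
  field
    prefix  : Prefix
    nVar    : ℕ
    clauses : List (Clause τ prefix nVar)
open EKROM public

Env : ℕ → Prefix → Set
Env n []            = ⊤
Env n ((a , b) ∷ ps) = Rel n a × Rel n b × Env n ps

lookupX : ∀ {n} (ps : Prefix) → Env n ps → (i : Fin (length ps)) → Rel n (xAr ps i)
lookupX ((a , b) ∷ ps) (X , Y , e) Fin.zero    = X
lookupX ((a , b) ∷ ps) (X , Y , e) (Fin.suc i) = lookupX ps e i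

lookupY : ∀ {n} (ps : Prefix) → Env n ps → (i : Fin (length ps)) → Rel n (yAr ps i)
lookupY ((a , b) ∷ ps) (X , Y , e) Fin.zero    = Y
lookupY ((a , b) ∷ ps) (X , Y , e) (Fin.suc i) = lookupY ps e i

QSat : ∀ n (ps : Prefix) → (Env n ps → Set) → Set
QSat n []             φ = φ tt
QSat n ((a , b) ∷ ps) φ =
  (X : Rel n a) → Σ (Rel n b) λ Y → QSat n ps (λ e → φ (X , Y , e))

module _ {τ : Vocab} {n : ℕ} (𝔄 : Structure τ n) {ps : Prefix} {nv : ℕ}
         (e : Env n ps) (s : Fin nv → Fin n) where

  evalT : Term τ nv → Fin n
  evalT (var x) = s x
  evalT (con c) = const 𝔄 c

  evalA : Atom τ ps nv → Bool
  evalA (eqA t u)   = ⌊ evalT t ≟ evalT u ⌋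
  evalA (relA r ts) = rel 𝔄 r (vmap evalT ts)
  evalA (xA i ts)   = lookupX ps e i (vmap evalT ts)

  evalY : YAtom τ ps nv → Bool
  evalY (yA i ts) = lookupY ps e i (vmap evalT ts)

  litHolds : {A : Set} → (A → Bool) → Lit A → Set
  litHolds ev (b , a) = ev a ≡ b

  ClauseHolds : Clause τ ps nv → Set
  ClauseHolds C = Any (litHolds evalA) (αs C) ⊎ Any (litHolds evalY) (hs C)

_⊨_ : ∀ {τ n} → Structure τ n → EKROM τ → Set
_⊨_ {τ} {n} 𝔄 Φ =
  QSat n (prefix Φ) λ e → (s : Fin (nVar Φ) → Fin n) →
    All (ClauseHolds 𝔄 e s) (clauses Φ)

{-# OPTIONS --safe #-}
module Submission where

-- The matrix ∀x̄ (C₁ ∧ ⋯ ∧ Cₙ) is universal first-order, hence preserved under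
-- substructures; the second-order prefix is handled by the game reading of
-- ∀X₁∃Y₁⋯∀Xₖ∃Yₖ. When the universal player picks Xᵢ on 𝔅, copy the move to 𝔄 by
-- extending Xᵢ arbitrarily (say by false) outside the image of 𝔅; the winning
-- answer Yᵢ on 𝔄 then restricts to an answer on 𝔅. At the end the relations on 𝔅
-- are the restrictions of those on 𝔄, so every clause instance over 𝔅 has the
-- same truth value as the corresponding instance over 𝔄.

open import Defs
open import Level using (0ℓ)
open import Data.Nat using (ℕ)
open import Data.Fin using (Fin; _≟_) renaming (zero to fzero; suc to fsuc)
open import Data.Fin.Properties using (any?)
open import Data.Bool using (false)
open import Data.Maybe using (Maybe; just; nothing; maybe′)
import Data.Maybe.Effectful as Maybe
open import Data.Vec using (Vec; []; _∷_) renaming (map to vmap)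
open import Data.List using ([]; _∷_)
open import Data.Vec.Properties using (map-∘; map-cong)
open import Data.Vec.Effectful using (module TraversableA)
open TraversableA (Maybe.applicative {0ℓ}) using (mapA)
open import Data.List.Relation.Unary.All as All using ()
open import Data.List.Relation.Unary.Any as Any using ()
open import Data.Product using (_×_; _,_)
open import Data.Sum using (inj₁; inj₂)
open import Data.Unit using (⊤)
open import Data.Empty using (⊥-elim)
open import Relation.Nullary using (yes; no; does)
open import Relation.Nullary.Decidable using (⌊_⌋; isYes≗does; does-⇔)
open import Relation.Binary.PropositionalEquality
open import Function using (_∘_)
open import Function.Bundles using (mk⇔)
open import Function.Definitions using (Injective)

module _ {m n : ℕ} (f : Fin m → Fin n) (f-inj : Injective _≡_ _≡_ f) where

  preimage : Fin n → Maybe (Fin m)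
  preimage j with any? (λ i → f i ≟ j)
  ... | yes (i , _) = just i
  ... | no _        = nothing

  preimage-apply : ∀ i → preimage (f i) ≡ just i
  preimage-apply i with any? (λ k → f k ≟ f i)
  ... | yes (k , fk≡fi) = cong just (f-inj fk≡fi)
  ... | no ∄k           = ⊥-elim (∄k (i , refl))

  preimageᵛ-map : ∀ {a} (w : Vec (Fin m) a) → mapA preimage (vmap f w) ≡ just w
  preimageᵛ-map []      = refl
  preimageᵛ-map (i ∷ w) rewrite preimage-apply i | preimageᵛ-map w = refl

  extendRel : ∀ {a} → Rel m a → Rel n a
  extendRel X v = maybe′ X false (mapA preimage v)

  extendRel-map : ∀ {a} (X : Rel m a) (w : Vec (Fin m) a) → extendRel X (vmap f w) ≡ X w
  extendRel-map X w = cong (maybe′ X false) (preimageᵛ-map w)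

IsRestriction : ∀ {m n} → (Fin m → Fin n) → (ps : Prefix) → Env m ps → Env n ps → Set
IsRestriction f []             _           _              = ⊤
IsRestriction f ((a , b) ∷ ps) (X , Y , e) (X′ , Y′ , e′) =
  (∀ w → X w ≡ X′ (vmap f w)) × (∀ w → Y w ≡ Y′ (vmap f w)) × IsRestriction f ps e e′

module _ {m n : ℕ} (f : Fin m → Fin n) where

  lookupX-restriction : ∀ ps {e e′} → IsRestriction f ps e e′ →
    ∀ i w → lookupX ps e i w ≡ lookupX ps e′ i (vmap f w)
  lookupX-restriction (_ ∷ ps) (hX , _ , _) fzero    = hX
  lookupX-restriction (_ ∷ ps) (_ , _ , r)  (fsuc i) = lookupX-restriction ps r i

  lookupY-restriction : ∀ ps {e e′} → IsRestriction f ps e e′ →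
    ∀ i w → lookupY ps e i w ≡ lookupY ps e′ i (vmap f w)
  lookupY-restriction (_ ∷ ps) (_ , hY , _) fzero    = hY
  lookupY-restriction (_ ∷ ps) (_ , _ , r)  (fsuc i) = lookupY-restriction ps r i

QSat-restrict : ∀ {m n} (f : Fin m → Fin n) → Injective _≡_ _≡_ f → ∀ ps
  {φA : Env n ps → Set} {φB : Env m ps → Set} →
  (∀ eB eA → IsRestriction f ps eB eA → φA eA → φB eB) →
  QSat n ps φA → QSat m ps φB
QSat-restrict f f-inj []             transfer sat   = transfer _ _ _ sat
QSat-restrict f f-inj ((a , b) ∷ ps) transfer sat X =
  let (Y′ , sat′) = sat (extendRel f f-inj X)
  in (λ w → Y′ (vmap f w)) ,
     QSat-restrict f f-inj ps
       (λ _ _ r → transfer _ _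
          ((λ w → sym (extendRel-map f f-inj X w)) , (λ _ → refl) , r))
       sat′

module _ {τ : Vocab} {m n : ℕ} {𝔅 : Structure τ m} {𝔄 : Structure τ n}
         (S : Substructure 𝔅 𝔄) where
  open Substructure S

  ⌊≟⌋-emb : ∀ x y → ⌊ x ≟ y ⌋ ≡ ⌊ emb x ≟ emb y ⌋
  ⌊≟⌋-emb x y = begin
    ⌊ x ≟ y ⌋              ≡⟨ isYes≗does (x ≟ y) ⟩
    does (x ≟ y)           ≡⟨ does-⇔ (mk⇔ (cong emb) emb-inj) (x ≟ y) (emb x ≟ emb y) ⟩
    does (emb x ≟ emb y)   ≡⟨ isYes≗does (emb x ≟ emb y) ⟨
    ⌊ emb x ≟ emb y ⌋      ∎
    where open ≡-Reasoning

  module _ {ps : Prefix} {nv : ℕ} (eB : Env m ps) (eA : Env n ps)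
           (r : IsRestriction emb ps eB eA) (s : Fin nv → Fin m) where

    evalT-emb : ∀ t → emb (evalT 𝔅 eB s t) ≡ evalT 𝔄 eA (emb ∘ s) t
    evalT-emb (var x) = refl
    evalT-emb (con c) = emb-const c

    evalTs-emb : ∀ {k} (ts : Vec (Term τ nv) k) →
      vmap emb (vmap (evalT 𝔅 eB s) ts) ≡ vmap (evalT 𝔄 eA (emb ∘ s)) ts
    evalTs-emb ts = trans (sym (map-∘ emb (evalT 𝔅 eB s) ts)) (map-cong evalT-emb ts)

    evalA-emb : ∀ α → evalA 𝔅 eB s α ≡ evalA 𝔄 eA (emb ∘ s) α
    evalA-emb (eqA t u)   =
      trans (⌊≟⌋-emb _ _) (cong₂ (λ x y → ⌊ x ≟ y ⌋) (evalT-emb t) (evalT-emb u))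
    evalA-emb (relA R ts) =
      trans (emb-rel R _) (cong (rel 𝔄 R) (evalTs-emb ts))
    evalA-emb (xA i ts)   =
      trans (lookupX-restriction emb ps r i _) (cong (lookupX ps eA i) (evalTs-emb ts))

    evalY-emb : ∀ η → evalY 𝔅 eB s η ≡ evalY 𝔄 eA (emb ∘ s) η
    evalY-emb (yA i ts) =
      trans (lookupY-restriction emb ps r i _) (cong (lookupY ps eA i) (evalTs-emb ts))

    ClauseHolds-restrict : ∀ {C} → ClauseHolds 𝔄 eA (emb ∘ s) C → ClauseHolds 𝔅 eB s C
    ClauseHolds-restrict (inj₁ α) = inj₁ (Any.map (λ { {_ , a} → trans (evalA-emb a) }) α)
    ClauseHolds-restrict (inj₂ η) = inj₂ (Any.map (λ { {_ , a} → trans (evalY-emb a) }) η)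

proposition4p2 : {τ : Vocab} (Φ : EKROM τ) {n m : ℕ}
                 (A : Structure τ n) (B : Structure τ m) →
                 Substructure B A → A ⊨ Φ → B ⊨ Φ
proposition4p2 Φ A B S =
  QSat-restrict emb emb-inj (prefix Φ)
    (λ eB eA r holds s →
       All.map (λ {C} → ClauseHolds-restrict S eB eA r s {C}) (holds (emb ∘ s)))
  where open Substructure S
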